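{- Let $n \ge 1$ be an integer. For $0 \le k \le n$ define $(0,1)$-matrices $A_k^{(n)}$ of size $\binom{n}{k}\times n$ recursively as follows: $A_0^{(n)} = \mathbf{0}^T$ (the $1\times n$ all-zero row), $A_n^{(n)} = \mathbf{1}^T$ (the $1\times n$ all-one row), and for $1 \le k \le n-1$ (with $n\ge 2$) $$A_k^{(n)} = \begin{bmatrix} A_{k-1}^{(n-1)} & \mathbf{1} \\ A_{k}^{(n-1)} & \mathbf{0} \end{bmatrix},$$ where $\mathbf{1}$ and $\mathbf{0}$ denote column vectors (of the appropriate lengths $\binom{n-1}{k-1}$ and $\binom{n-1}{k}$ respectively) consisting only of $1$s and only of $0$s. Let $S^{(n)}$ be the $2^n \times n$ matrix obtained by stacking $A_0^{(n)}, A_1^{(n)}, \dots, A_n^{(n)}$ vertically in this order. Then the row vectors of $S^{(n)}$, read from top to bottom, are exactly all the vertices of the $n$-cube $Q^{(n)}$, each appearing once, listed in increasing Hales order.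
   Context: The $n$-cube $Q^{(n)}$ is the graph with vertex set $\{0,1\}^n$, two vertices being adjacent iff they differ in exactly one coordinate. For a vertex $u$, $w(u)$ denotes its Hamming weight (number of $1$ entries). The Hales order $\le_H$ on $\{0,1\}^n$ is the total order defined by $u \le_H v$ iff either (1) $w(u) < w(v)$, or (2) $w(u) = w(v)$ and $u$ is greater than $v$ in the lexicographic order relative to the right-to-left order of the coordinates (i.e. lexicographic order in which the rightmost coordinate is compared first, then the next one to its left, etc.). -}

module Defs where

open import Data.Bool using (Bool; true; false)
open import Data.Nat using (ℕ; zero; suc; _<_; _≟_; _<?_)
open import Data.List using (List; []; _∷_; [_]; map; _++_; concatMap; upTo; reverse)
open import Data.Vec using (Vec; replicate; _∷ʳ_; toList)
open import Data.Product using (_×_)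
open import Data.Sum using (_⊎_)
open import Relation.Nullary using (yes; no)
open import Relation.Binary.PropositionalEquality using (_≡_)

-- Vertices of the n-cube Q^(n): 0/1 vectors of length n (false = 0, true = 1).
Vertex : ℕ → Set
Vertex n = Vec Bool n

weight : {n : ℕ} → Vertex n → ℕ
weight Vec.[] = 0
weight (true Vec.∷ u) = suc (weight u)
weight (false Vec.∷ u) = weight u

data LexGT : List Bool → List Bool → Set where
  here  : ∀ {xs ys} → LexGT (true ∷ xs) (false ∷ ys)
  there : ∀ {b xs ys} → LexGT xs ys → LexGT (b ∷ xs) (b ∷ ys)

RevLexGT : {n : ℕ} → Vertex n → Vertex n → Set
RevLexGT u v = LexGT (reverse (toList u)) (reverse (toList v))

_<H_ : {n : ℕ} → Vertex n → Vertex n → Set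
u <H v = (weight u < weight v) ⊎ ((weight u ≡ weight v) × RevLexGT u v)

-- Matrix A_k^(n), as the list of its rows (top to bottom).
-- For k > n (never used) the list is empty.
A : (n k : ℕ) → List (Vec Bool n)
A n zero = [ replicate n false ]
A zero (suc k) = []
A (suc m) (suc k) with suc k ≟ suc m
... | yes _ = [ replicate (suc m) true ]
... | no _ with suc k <? suc m
...   | yes _ = map (_∷ʳ true) (A m k) ++ map (_∷ʳ false) (A m (suc k))
...   | no _ = []

S : (n : ℕ) → List (Vec Bool n)
S n = concatMap (A n) (upTo (suc n))

-- The k-th block A_k^(n) lists exactly the vertices of weight k, and by induction on n it
-- lists them in decreasing right-to-left lexicographic order: the rows ending in 1 come
-- before those ending in 0, and within each half the order is inherited from A^(n-1)
-- because the appended last coordinate is the first one compared. Stacking the blocks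
-- by increasing k therefore lists every vertex exactly once, in strictly increasing
-- Hales order.
module Submission where

open import Defs
open import Data.Bool using (true; false)
open import Data.Nat using (ℕ; zero; suc; _≤_; _<_; _≟_; _<?_; z≤n; s≤s)
open import Data.Nat.Properties using (<-irrefl; <-cmp; ≤-trans; n≤1+n; suc-injective; <-asym; <⇒≱)
open import Data.List using (List; []; _∷_; [_]; map; _++_; reverse)
open import Data.List.Properties using (reverse-++)
open import Data.Vec using (replicate; _∷ʳ_; toList; initLast)
open import Data.Vec.Properties using (toList-∷ʳ)
import Data.Vec as Vec
open import Data.Product using (_×_; _,_)
open import Data.Sum using (inj₁; inj₂)
open import Function using (id)
open import Relation.Binary.Definitions using (tri<; tri≈; tri>)
open import Relation.Binary.PropositionalEquality
  using (_≡_; _≢_; refl; sym; trans; cong; subst; subst₂)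
open import Relation.Nullary using (¬_; yes; no; contradiction)
open import Data.List.Relation.Unary.Any using (here)
open import Data.List.Membership.Propositional using (_∈_; lose)
open import Data.List.Membership.Propositional.Properties
  using (∈-++⁺ˡ; ∈-++⁺ʳ; ∈-map⁺; ∈-concatMap⁺; ∈-upTo⁺)
open import Data.List.Relation.Unary.All as All using (All; []; _∷_)
import Data.List.Relation.Unary.All.Properties as All
open import Data.List.Relation.Unary.AllPairs as AllPairs using (AllPairs; []; _∷_)
import Data.List.Relation.Unary.AllPairs.Properties as AllPairs
open import Data.List.Relation.Unary.Unique.Propositional using (Unique)
open import Data.List.Relation.Unary.Linked using (Linked)
open import Data.List.Relation.Unary.Linked.Properties using (AllPairs⇒Linked)

weight-∷ʳ-true : ∀ {n} (x : Vertex n) → weight (x ∷ʳ true) ≡ suc (weight x)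
weight-∷ʳ-true Vec.[] = refl
weight-∷ʳ-true (true Vec.∷ x) = cong suc (weight-∷ʳ-true x)
weight-∷ʳ-true (false Vec.∷ x) = weight-∷ʳ-true x

weight-∷ʳ-false : ∀ {n} (x : Vertex n) → weight (x ∷ʳ false) ≡ weight x
weight-∷ʳ-false Vec.[] = refl
weight-∷ʳ-false (true Vec.∷ x) = cong suc (weight-∷ʳ-false x)
weight-∷ʳ-false (false Vec.∷ x) = weight-∷ʳ-false x

weight-replicate-false : ∀ n → weight (replicate n false) ≡ 0
weight-replicate-false zero = refl
weight-replicate-false (suc n) = weight-replicate-false n

weight-replicate-true : ∀ n → weight (replicate n true) ≡ n
weight-replicate-true zero = refl
weight-replicate-true (suc n) = cong suc (weight-replicate-true n)

weight≤n : ∀ {n} (x : Vertex n) → weight x ≤ n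
weight≤n Vec.[] = z≤n
weight≤n (true Vec.∷ x) = s≤s (weight≤n x)
weight≤n (false Vec.∷ x) = ≤-trans (weight≤n x) (n≤1+n _)

weight≡0⇒replicate-false : ∀ {n} (x : Vertex n) → weight x ≡ 0 → x ≡ replicate n false
weight≡0⇒replicate-false Vec.[] _ = refl
weight≡0⇒replicate-false (false Vec.∷ x) w≡0 = cong (false Vec.∷_) (weight≡0⇒replicate-false x w≡0)

weight≡n⇒replicate-true : ∀ {n} (x : Vertex n) → weight x ≡ n → x ≡ replicate n true
weight≡n⇒replicate-true Vec.[] _ = refl
weight≡n⇒replicate-true (true Vec.∷ x) w≡n =
  cong (true Vec.∷_) (weight≡n⇒replicate-true x (suc-injective w≡n))
weight≡n⇒replicate-true (false Vec.∷ x) w≡n = contradiction (s≤s (weight≤n x)) (<-irrefl w≡n)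

reverse-toList-∷ʳ : ∀ {n} (x : Vertex n) b → reverse (toList (x ∷ʳ b)) ≡ b ∷ reverse (toList x)
reverse-toList-∷ʳ x b = trans (cong reverse (toList-∷ʳ b x)) (reverse-++ (toList x) [ b ])

RevLexGT-∷ʳ : ∀ {n b} {x y : Vertex n} → RevLexGT x y → RevLexGT (x ∷ʳ b) (y ∷ʳ b)
RevLexGT-∷ʳ {b = b} {x} {y} x>y rewrite reverse-toList-∷ʳ x b | reverse-toList-∷ʳ y b = there x>y

∷ʳ-sorted-RevLexGT : ∀ {n} b {xs : List (Vertex n)} →
  AllPairs RevLexGT xs → AllPairs RevLexGT (map (_∷ʳ b) xs)
∷ʳ-sorted-RevLexGT b sorted = AllPairs.map⁺ (AllPairs.map (λ {x} {y} → RevLexGT-∷ʳ {x = x} {y}) sorted)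

RevLexGT-∷ʳ-true-false : ∀ {n} (x y : Vertex n) → RevLexGT (x ∷ʳ true) (y ∷ʳ false)
RevLexGT-∷ʳ-true-false x y rewrite reverse-toList-∷ʳ x true | reverse-toList-∷ʳ y false = here

LexGT-irrefl : ∀ {xs} → ¬ LexGT xs xs
LexGT-irrefl (there xs>xs) = LexGT-irrefl xs>xs

<H⇒≢ : ∀ {n} {x y : Vertex n} → x <H y → x ≢ y
<H⇒≢ (inj₁ w<w) refl = <-irrefl refl w<w
<H⇒≢ (inj₂ (_ , x>x)) refl = LexGT-irrefl x>x

equal-weight-RevLexGT⇒<H : ∀ {n k} {xs : List (Vertex n)} →
  All (λ x → weight x ≡ k) xs → AllPairs RevLexGT xs → AllPairs _<H_ xs
equal-weight-RevLexGT⇒<H [] [] = []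
equal-weight-RevLexGT⇒<H (wx ∷ ws) (x>ys ∷ sorted) =
  All.zipWith (λ (wy , x>y) → inj₂ (trans wx (sym wy) , x>y)) (ws , x>ys)
  ∷ equal-weight-RevLexGT⇒<H ws sorted

A-suc-< : ∀ {m k} → k < m →
  A (suc m) (suc k) ≡ map (_∷ʳ true) (A m k) ++ map (_∷ʳ false) (A m (suc k))
A-suc-< {m} {k} k<m with suc k ≟ suc m
... | yes k≡m = contradiction k<m (<-irrefl (suc-injective k≡m))
... | no _ with suc k <? suc m
...   | yes _ = refl
...   | no k≮m = contradiction (s≤s k<m) k≮m

A-suc-≡ : ∀ m → A (suc m) (suc m) ≡ [ replicate (suc m) true ]
A-suc-≡ m with suc m ≟ suc m
... | yes _ = refl
... | no m≢m = contradiction refl m≢m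

A-suc-> : ∀ {m k} → m < k → A (suc m) (suc k) ≡ []
A-suc-> {m} {k} m<k with suc k ≟ suc m
... | yes k≡m = contradiction m<k (<-irrefl (sym (suc-injective k≡m)))
... | no _ with suc k <? suc m
...   | yes (s≤s k<m) = contradiction m<k (<-asym k<m)
...   | no _ = refl

A-weight : ∀ n k → All (λ x → weight x ≡ k) (A n k)
A-weight n zero = weight-replicate-false n ∷ []
A-weight zero (suc k) = []
A-weight (suc m) (suc k) with <-cmp k m
... | tri< k<m _ _ rewrite A-suc-< k<m =
  All.++⁺ (All.map⁺ (All.map (λ {x} wx → trans (weight-∷ʳ-true x) (cong suc wx)) (A-weight m k)))
          (All.map⁺ (All.map (λ {x} wx → trans (weight-∷ʳ-false x) wx) (A-weight m (suc k))))
... | tri≈ _ refl _ rewrite A-suc-≡ m = weight-replicate-true (suc m) ∷ []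
... | tri> _ _ m<k rewrite A-suc-> m<k = []

∈-A : ∀ n k (v : Vertex n) → weight v ≡ k → v ∈ A n k
∈-A n zero v w≡0 = here (weight≡0⇒replicate-false v w≡0)
∈-A zero (suc k) Vec.[] ()
∈-A (suc m) (suc k) v w≡k with <-cmp k m
... | tri< k<m _ _ with initLast v
...   | xs , true , refl rewrite A-suc-< k<m =
  ∈-++⁺ˡ (∈-map⁺ (_∷ʳ true) (∈-A m k xs (suc-injective (trans (sym (weight-∷ʳ-true xs)) w≡k))))
...   | xs , false , refl rewrite A-suc-< k<m =
  ∈-++⁺ʳ _ (∈-map⁺ (_∷ʳ false) (∈-A m (suc k) xs (trans (sym (weight-∷ʳ-false xs)) w≡k)))
∈-A (suc m) (suc m) v w≡m | tri≈ _ refl _ rewrite A-suc-≡ m = here (weight≡n⇒replicate-true v w≡m)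
∈-A (suc m) (suc k) v w≡k | tri> _ _ m<k =
  contradiction (subst (_≤ suc m) w≡k (weight≤n v)) (<⇒≱ (s≤s m<k))

A-sorted-RevLexGT : ∀ n k → AllPairs RevLexGT (A n k)
A-sorted-RevLexGT n zero = [] ∷ []
A-sorted-RevLexGT zero (suc k) = []
A-sorted-RevLexGT (suc m) (suc k) with <-cmp k m
... | tri< k<m _ _ rewrite A-suc-< k<m =
  AllPairs.++⁺ (∷ʳ-sorted-RevLexGT true (A-sorted-RevLexGT m k))
               (∷ʳ-sorted-RevLexGT false (A-sorted-RevLexGT m (suc k)))
               (All.map⁺ (All.universal (λ x → All.map⁺ (All.universal (RevLexGT-∷ʳ-true-false x) _)) _))
... | tri≈ _ refl _ rewrite A-suc-≡ m = [] ∷ []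
... | tri> _ _ m<k rewrite A-suc-> m<k = []

A-sorted-<H : ∀ n k → AllPairs _<H_ (A n k)
A-sorted-<H n k = equal-weight-RevLexGT⇒<H (A-weight n k) (A-sorted-RevLexGT n k)

A-<H-A : ∀ n {i j} → i < j → All (λ x → All (x <H_) (A n j)) (A n i)
A-<H-A n {i} {j} i<j =
  All.map (λ wx → All.map (λ wy → inj₁ (subst₂ _<_ (sym wx) (sym wy) i<j)) (A-weight n j))
          (A-weight n i)

S-complete : ∀ n (v : Vertex n) → v ∈ S n
S-complete n v = ∈-concatMap⁺ (A n) (lose (∈-upTo⁺ (s≤s (weight≤n v))) (∈-A n (weight v) v refl))

S-sorted : ∀ n → AllPairs _<H_ (S n)
S-sorted n = AllPairs.concat⁺
  (All.map⁺ (All.applyUpTo⁺₂ id (suc n) (A-sorted-<H n)))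
  (AllPairs.map⁺ (AllPairs.applyUpTo⁺₁ id (suc n) (λ i<j _ → A-<H-A n i<j)))

lemma1 : (n : ℕ) → 1 ≤ n →
    ((v : Vertex n) → v ∈ S n) × Unique (S n) × Linked _<H_ (S n)
lemma1 n _ = S-complete n , AllPairs.map <H⇒≢ (S-sorted n) , AllPairs⇒Linked (S-sorted n)
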